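{- Let $n\ge1$, let $s$ be an integer with $n/2<s\le n$, and let $\tilde\gamma_s\in\{0,1\}^n$ consist of $n-s$ zeros followed by $s$ ones. If $\tilde\alpha\in\{0,1\}^n$ has at least $n/2+1$ components equal to $1$ and $\tilde\alpha\not\le\tilde\gamma_s$, then $\mathcal D(\tilde\alpha)\not\le\tilde\gamma_s$.
   Context: Order on $\{0,1\}^n$ is componentwise. Let $B_+^n$ be the set of tuples with more than $n/2$ ones. Indices are cyclic modulo $n$. For $i,j\in\{1,\dots,n\}$ the segment $\tilde\alpha[i:j]$ is $(\alpha_i,\dots,\alpha_j)$ if $i\le j$ and $(\alpha_i,\dots,\alpha_n,\alpha_1,\dots,\alpha_j)$ if $i>j$. Its prefixes are the segments $\tilde\alpha[i:j']$ with $j'$ strictly before $j$ in the cyclic traversal from $i$. A segment is balanced / $0$-dominated if its number of zeros is equal to / greater than its number of ones. A minimal balanced segment is a balanced segment every prefix of which is $0$-dominated. A component $\alpha_i=0$ and a component $\alpha_j=1$ are connected if $\tilde\alpha[i:j]$ is a minimal balanced segment. A component is bound if it is connected to some component, unbound otherwise. For $\tilde\alpha\in B_+^n$, $\mathcal D(\tilde\alpha)$ is obtained from $\tilde\alpha$ by replacing with $0$ the unbound component equal to $1$ having the largest index. -}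

module Defs where

open import Data.Nat using (ℕ; zero; suc; _+_; _*_; _∸_; _≤_; _<_; _≤ᵇ_)
open import Data.Bool using (Bool; true; false; _∧_; not)
import Data.Bool as B
open import Data.Fin using (Fin; toℕ)
open import Data.List using (List; []; _∷_; _++_; map; filter; allFin; length; take)
open import Data.Product using (Σ; _×_; _,_; ∃)
open import Relation.Binary.PropositionalEquality using (_≡_; _≢_)
open import Relation.Nullary using (¬_)
open import Relation.Nullary.Decidable using (Dec; _×-dec_)
open import Data.Nat using (_≤?_)
open import Data.Vec.Functional using (Vector; updateAt)

-- Tuples in {0,1}^n : functions Fin n → Bool (true = 1, false = 0).
-- Indices are 0-based here: Fin n = {0,…,n-1} corresponds to {1,…,n}.
Tuple : ℕ → Set
Tuple n = Fin n → Bool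

ones : List Bool → ℕ
ones []          = 0
ones (true ∷ xs) = suc (ones xs)
ones (false ∷ xs) = ones xs

zeros : List Bool → ℕ
zeros []           = 0
zeros (true ∷ xs)  = zeros xs
zeros (false ∷ xs) = suc (zeros xs)

onesT : ∀ {n} → Tuple n → ℕ
onesT {n} α = ones (map α (allFin n))

_≤ᵗ_ : ∀ {n} → Tuple n → Tuple n → Set
α ≤ᵗ β = ∀ k → α k B.≤ β k

InBplus : ∀ {n} → Tuple n → Set
InBplus {n} α = n < 2 * onesT α

range : (n lo hi : ℕ) → List (Fin n)
range n lo hi = filter (λ k → (lo ≤? toℕ k) ×-dec (toℕ k ≤? hi)) (allFin n)

seg : ∀ {n} → Tuple n → Fin n → Fin n → List Bool
seg {n} α i j with toℕ i ≤ᵇ toℕ j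
... | true  = map α (range n (toℕ i) (toℕ j))
... | false = map α (range n (toℕ i) (n ∸ 1)) ++ map α (range n 0 (toℕ j))

Balanced : List Bool → Set
Balanced xs = zeros xs ≡ ones xs

ZeroDominated : List Bool → Set
ZeroDominated xs = ones xs < zeros xs

-- the prefixes of α̃[i:j] are the segments α̃[i:j'] with j' strictly before j
-- in the traversal from i, i.e. the nonempty proper initial parts of the list
MinimalBalanced : List Bool → Set
MinimalBalanced xs =
  Balanced xs × (∀ k → 1 ≤ k → k < length xs → ZeroDominated (take k xs))

Connected : ∀ {n} → Tuple n → Fin n → Fin n → Set
Connected α i j = α i ≡ false × α j ≡ true × MinimalBalanced (seg α i j)

BoundOne : ∀ {n} → Tuple n → Fin n → Set
BoundOne α j = ∃ λ i → Connected α i j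

UnboundOne : ∀ {n} → Tuple n → Fin n → Set
UnboundOne α j = α j ≡ true × ¬ BoundOne α j

LargestUnboundOne : ∀ {n} → Tuple n → Fin n → Set
LargestUnboundOne α j = UnboundOne α j × (∀ k → UnboundOne α k → toℕ k ≤ toℕ j)

-- 𝒟(α̃) when j is the largest unbound 1 of α̃
replaceByZero : ∀ {n} → Tuple n → Fin n → Tuple n
replaceByZero α j = updateAt α j (λ _ → false)

gamma : (n s : ℕ) → Tuple n
gamma n s k = (n ∸ s) ≤ᵇ toℕ k

module Submission where

-- Let j be the largest unbound 1 of α̃, so that 𝒟(α̃) is α̃ with α_j set to 0.
-- To see 𝒟(α̃) ≰ γ̃_s it suffices to exhibit a 1 of α̃ at an index w ≠ j with
-- γ_w = 0, since that 1 survives the replacement.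
--
-- The combinatorial core is that α̃ has at least two unbound 1s.  A 0 is connected
-- to at most one 1: two cyclic segments starting at the same index are nested, and a
-- minimal balanced segment has no balanced proper prefix.  Hence sending each bound 1
-- to its partner 0 is injective, so if all 1s but one were bound we would have
-- #ones ≤ #zeros + 1, i.e. 2·#ones ≤ n + 1, contradicting 2·#ones ≥ n + 2.
--
-- The theorem follows: take w with α_w = 1 and γ_w = 0 (it exists as α̃ ≰ γ̃_s).
-- If γ_j = 1 then w ≠ j.  If γ_j = 0, any other unbound 1 k lies below j, and since
-- γ̃_s is upward closed in the index, γ_k = 0 as well.

open import Defs
open import Data.Nat using (ℕ; zero; suc; _+_; _*_; _∸_; _≤_; _<_; _≤ᵇ_; z≤n; s≤s)
open import Data.Nat.Properties
open import Data.Bool using (Bool; true; false; T)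
import Data.Bool as B
import Data.Bool.Properties as BP
open import Data.Fin using (Fin; toℕ; zero; suc; fromℕ<)
import Data.Fin.Properties as FP
open import Data.List using (List; []; _∷_; _++_; map; filter; allFin; length; take)
open import Data.List.Properties
  using (filter-accept; filter-reject; filter-none; filter-some; map-++; ++-assoc;
         length-++; length-map; length-++-sucʳ; length-++-≤ˡ; length-++-≤ʳ; length-tabulate)
open import Data.List.Membership.Propositional using (_∈_; lose)
open import Data.List.Membership.Propositional.Properties using (∈-filter⁺; ∈-filter⁻; ∈-allFin; ∈-∃++)
open import Data.List.Relation.Unary.Any using (here; there)
import Data.List.Relation.Unary.All as All
open import Data.List.Relation.Unary.AllPairs using (AllPairs; []; _∷_)
import Data.List.Relation.Unary.AllPairs as AllPairs
import Data.List.Relation.Unary.AllPairs.Properties as AllPairs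
open import Data.List.Relation.Unary.Unique.Propositional using (Unique)
import Data.List.Relation.Unary.Unique.Propositional.Properties as Unique
open import Data.Product using (Σ; _×_; _,_; ∃; proj₁; proj₂)
open import Data.Sum using (_⊎_; inj₁; inj₂; [_,_])
open import Data.Empty using (⊥; ⊥-elim)
open import Data.Vec.Functional.Properties using (updateAt-minimal)
open import Function.Bundles using (Equivalence)
open import Level using (0ℓ)
open import Relation.Binary using (tri<; tri≈; tri>)
open import Relation.Binary.PropositionalEquality hiding ([_])
open import Relation.Nullary using (¬_; Dec; yes; no)
open import Relation.Nullary.Decidable using (_×-dec_; _→-dec_; ¬?; map′)
open import Relation.Unary using (Pred; Decidable)

ProperPrefix : {A : Set} → List A → List A → Set
ProperPrefix {A} xs ys = Σ (List A) λ zs → 0 < length zs × ys ≡ xs ++ zs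

take-length-++ : {A : Set} (xs zs : List A) → take (length xs) (xs ++ zs) ≡ xs
take-length-++ []       zs = refl
take-length-++ (x ∷ xs) zs = cong (x ∷_) (take-length-++ xs zs)

minimalBalanced-noBalancedPrefix : (xs ys : List Bool) → 0 < length xs →
  Balanced xs → MinimalBalanced ys → ¬ ProperPrefix xs ys
minimalBalanced-noBalancedPrefix xs ys xs≢[] bal (_ , prefixes) (zs , zs≢[] , refl) =
  <-irrefl (sym bal) (subst ZeroDominated (take-length-++ xs zs) (prefixes (length xs) xs≢[] shorter))
  where
  shorter : length xs < length (xs ++ zs)
  shorter = subst (length xs <_) (sym (length-++ xs)) (m<m+n (length xs) zs≢[])

module _ {A : Set} {P Q R : Pred A 0ℓ} (P? : Decidable P) (Q? : Decidable Q) (R? : Decidable R)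
  (R⇒P⊎Q : ∀ x → R x → P x ⊎ Q x) (P⇒R : ∀ x → P x → R x) (Q⇒R : ∀ x → Q x → R x)
  (disjoint : ∀ x → Q x → ¬ P x) where

  filter-split : ∀ xs → AllPairs (λ a b → Q a → ¬ P b) xs →
                 filter R? xs ≡ filter P? xs ++ filter Q? xs
  filter-split []       []               = refl
  filter-split (x ∷ xs) (Qx⇒¬Ps ∷ sorted) with P? x
  ... | yes Px rewrite filter-accept R? {x} {xs} (P⇒R x Px)
                     | filter-reject Q? {x} {xs} (λ Qx → disjoint x Qx Px)
    = cong (x ∷_) (filter-split xs sorted)
  ... | no ¬Px with Q? x
  ...   | yes Qx rewrite filter-accept R? {x} {xs} (Q⇒R x Qx)
                       | filter-split xs sorted
                       | filter-none P? (All.map (λ Qx⇒¬P → Qx⇒¬P Qx) Qx⇒¬Ps)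
    = refl
  ...   | no ¬Qx rewrite filter-reject R? {x} {xs} (λ Rx → [ ¬Px , ¬Qx ] (R⇒P⊎Q x Rx))
    = filter-split xs sorted

inInterval? : ∀ {n} (lo hi : ℕ) → Decidable (λ (k : Fin n) → lo ≤ toℕ k × toℕ k ≤ hi)
inInterval? lo hi k = (lo ≤? toℕ k) ×-dec (toℕ k ≤? hi)

allFin-increasing : ∀ n → AllPairs (λ a b → toℕ a < toℕ b) (allFin n)
allFin-increasing n = AllPairs.tabulate⁺-< (λ i<j → i<j)

range-split : ∀ n {lo h h'} → lo ≤ suc h → h ≤ h' →
              range n lo h' ≡ range n lo h ++ range n (suc h) h'
range-split n {lo} {h} {h'} lo≤h+1 h≤h' =
  filter-split (inInterval? lo h) (inInterval? (suc h) h') (inInterval? lo h')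
    split (λ _ (lo≤k , k≤h) → lo≤k , ≤-trans k≤h h≤h') (λ _ (h<k , k≤h') → ≤-trans lo≤h+1 h<k , k≤h')
    (λ _ (h<k , _) (_ , k≤h) → <-irrefl refl (≤-<-trans k≤h h<k))
    (allFin n)
    (AllPairs.map (λ a<b (h<a , _) (_ , b≤h) → <-irrefl refl (<-≤-trans (<-trans h<a a<b) b≤h))
                  (allFin-increasing n))
  where
  split : ∀ k → lo ≤ toℕ k × toℕ k ≤ h' → (lo ≤ toℕ k × toℕ k ≤ h) ⊎ (suc h ≤ toℕ k × toℕ k ≤ h')
  split k (lo≤k , k≤h') with toℕ k ≤? h
  ... | yes k≤h = inj₁ (lo≤k , k≤h)
  ... | no  k≰h = inj₂ (≰⇒> k≰h , k≤h')

range-nonEmpty : ∀ {n lo hi} (k : Fin n) → lo ≤ toℕ k → toℕ k ≤ hi → 0 < length (range n lo hi)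
range-nonEmpty {lo = lo} {hi} k lo≤k k≤hi = filter-some (inInterval? lo hi) (lose (∈-allFin k) (lo≤k , k≤hi))

arc : (n : ℕ) → Fin n → Fin n → List (Fin n)
arc n i j with toℕ i ≤ᵇ toℕ j
... | true  = range n (toℕ i) (toℕ j)
... | false = range n (toℕ i) (n ∸ 1) ++ range n 0 (toℕ j)

seg≡map-arc : ∀ {n} (α : Tuple n) i j → seg α i j ≡ map α (arc n i j)
seg≡map-arc {n} α i j with toℕ i ≤ᵇ toℕ j
... | true  = refl
... | false = sym (map-++ α (range n (toℕ i) (n ∸ 1)) (range n 0 (toℕ j)))

arc-forward : ∀ {n} (i j : Fin n) → toℕ i ≤ toℕ j → arc n i j ≡ range n (toℕ i) (toℕ j)
arc-forward i j i≤j with toℕ i ≤ᵇ toℕ j | ≤⇒≤ᵇ i≤j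
... | true | _ = refl

arc-wrap : ∀ {n} (i j : Fin n) → toℕ j < toℕ i →
           arc n i j ≡ range n (toℕ i) (n ∸ 1) ++ range n 0 (toℕ j)
arc-wrap i j j<i with toℕ i ≤ᵇ toℕ j in i≤ᵇj
... | true  = ⊥-elim (<-irrefl refl (<-≤-trans j<i (≤ᵇ⇒≤ (toℕ i) (toℕ j) (subst T (sym i≤ᵇj) _))))
... | false = refl

arc-nonEmpty : ∀ {n} (i j : Fin n) → 0 < length (arc n i j)
arc-nonEmpty {n} i j with toℕ i ≤? toℕ j
... | yes i≤j rewrite arc-forward i j i≤j = range-nonEmpty i ≤-refl i≤j
... | no  i≰j rewrite arc-wrap i j (≰⇒> i≰j) =
  <-≤-trans (range-nonEmpty i ≤-refl (FP.toℕ≤pred[n] i)) (length-++-≤ˡ (range n (toℕ i) (n ∸ 1)))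

arcs-nested : ∀ {n} (i k k' : Fin n) → toℕ k < toℕ k' →
  ProperPrefix (arc n i k) (arc n i k') ⊎ ProperPrefix (arc n i k') (arc n i k)
arcs-nested {n} i k k' k<k' with toℕ i ≤? toℕ k | toℕ i ≤? toℕ k'
-- i ≤ k < k': the arc to k' continues the arc to k through (k, k'].
... | yes i≤k | _ = inj₁ (between , range-nonEmpty k' k<k' ≤-refl , extends)
  where
  open ≡-Reasoning
  between : List (Fin n)
  between = range n (suc (toℕ k)) (toℕ k')
  extends : arc n i k' ≡ arc n i k ++ between
  extends = begin
    arc n i k'                         ≡⟨ arc-forward i k' (≤-trans i≤k (<⇒≤ k<k')) ⟩
    range n (toℕ i) (toℕ k')           ≡⟨ range-split n (m≤n⇒m≤1+n i≤k) (<⇒≤ k<k') ⟩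
    range n (toℕ i) (toℕ k) ++ between ≡⟨ cong (_++ between) (arc-forward i k i≤k) ⟨
    arc n i k ++ between               ∎
-- k < i ≤ k': the arc to k passes k', wraps around and continues up to k.
... | no i≰k | yes i≤k' = inj₂ (beyond ++ initial , nonEmpty , extends)
  where
  open ≡-Reasoning
  beyond initial : List (Fin n)
  beyond  = range n (suc (toℕ k')) (n ∸ 1)
  initial = range n 0 (toℕ k)
  nonEmpty : 0 < length (beyond ++ initial)
  nonEmpty = <-≤-trans (range-nonEmpty k z≤n ≤-refl) (length-++-≤ʳ initial {beyond})
  extends : arc n i k ≡ arc n i k' ++ (beyond ++ initial)
  extends = begin
    arc n i k                                         ≡⟨ arc-wrap i k (≰⇒> i≰k) ⟩
    range n (toℕ i) (n ∸ 1) ++ initial                ≡⟨ cong (_++ initial) (range-split n (m≤n⇒m≤1+n i≤k') (FP.toℕ≤pred[n] k')) ⟩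
    (range n (toℕ i) (toℕ k') ++ beyond) ++ initial   ≡⟨ ++-assoc (range n (toℕ i) (toℕ k')) beyond initial ⟩
    range n (toℕ i) (toℕ k') ++ (beyond ++ initial)   ≡⟨ cong (_++ (beyond ++ initial)) (arc-forward i k' i≤k') ⟨
    arc n i k' ++ (beyond ++ initial)                 ∎
-- k < k' < i: both arcs wrap, and the arc to k' continues the arc to k through (k, k'].
... | no i≰k | no i≰k' = inj₁ (between , range-nonEmpty k' k<k' ≤-refl , extends)
  where
  open ≡-Reasoning
  wrapped between : List (Fin n)
  wrapped = range n (toℕ i) (n ∸ 1)
  between = range n (suc (toℕ k)) (toℕ k')
  extends : arc n i k' ≡ arc n i k ++ between
  extends = begin
    arc n i k'                                     ≡⟨ arc-wrap i k' (≰⇒> i≰k') ⟩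
    wrapped ++ range n 0 (toℕ k')                  ≡⟨ cong (wrapped ++_) (range-split n z≤n (<⇒≤ k<k')) ⟩
    wrapped ++ (range n 0 (toℕ k) ++ between)      ≡⟨ ++-assoc wrapped (range n 0 (toℕ k)) between ⟨
    (wrapped ++ range n 0 (toℕ k)) ++ between      ≡⟨ cong (_++ between) (arc-wrap i k (≰⇒> i≰k)) ⟨
    arc n i k ++ between                           ∎

map-properPrefix : {A B : Set} (f : A → B) {xs ys : List A} →
                   ProperPrefix xs ys → ProperPrefix (map f xs) (map f ys)
map-properPrefix f {xs} (zs , zs≢[] , refl) =
  map f zs , subst (0 <_) (sym (length-map f zs)) zs≢[] , map-++ f xs zs

seg-nonEmpty : ∀ {n} (α : Tuple n) i j → 0 < length (seg α i j)
seg-nonEmpty {n} α i j rewrite seg≡map-arc α i j | length-map α (arc n i j) = arc-nonEmpty i j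

segments-nested : ∀ {n} (α : Tuple n) (i k k' : Fin n) → toℕ k < toℕ k' →
  ProperPrefix (seg α i k) (seg α i k') ⊎ ProperPrefix (seg α i k') (seg α i k)
segments-nested α i k k' k<k'
  rewrite seg≡map-arc α i k | seg≡map-arc α i k' with arcs-nested i k k' k<k'
... | inj₁ shorter = inj₁ (map-properPrefix α shorter)
... | inj₂ longer  = inj₂ (map-properPrefix α longer)

-- Of two minimal balanced segments starting at the same index, one would be a
-- balanced proper prefix of the other; so distinct ends are impossible.
minimalBalanced-sameStart : ∀ {n} (α : Tuple n) (i k k' : Fin n) → toℕ k < toℕ k' →
  MinimalBalanced (seg α i k) → MinimalBalanced (seg α i k') → ⊥
minimalBalanced-sameStart α i k k' k<k' mb mb' with segments-nested α i k k' k<k'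
... | inj₁ p = minimalBalanced-noBalancedPrefix _ _ (seg-nonEmpty α i k) (proj₁ mb) mb' p
... | inj₂ p = minimalBalanced-noBalancedPrefix _ _ (seg-nonEmpty α i k') (proj₁ mb') mb p

connected-unique : ∀ {n} (α : Tuple n) {i k k'} → Connected α i k → Connected α i k' → k ≡ k'
connected-unique α {i} {k} {k'} (_ , _ , mb) (_ , _ , mb') with <-cmp (toℕ k) (toℕ k')
... | tri< k<k' _ _ = ⊥-elim (minimalBalanced-sameStart α i k k' k<k' mb mb')
... | tri≈ _ k≡k' _ = FP.toℕ-injective k≡k'
... | tri> _ _ k'<k = ⊥-elim (minimalBalanced-sameStart α i k' k k'<k mb' mb)

true≢false : true ≢ false
true≢false = BP.not-¬ refl

isOne? : ∀ {n} (α : Tuple n) → Decidable (λ k → α k ≡ true)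
isOne? α k = α k BP.≟ true

isZero? : ∀ {n} (α : Tuple n) → Decidable (λ k → α k ≡ false)
isZero? α k = α k BP.≟ false

minimalBalanced? : ∀ xs → Dec (MinimalBalanced xs)
minimalBalanced? xs = (zeros xs ≟ ones xs) ×-dec map′ (λ f k 1≤k k<len → f k<len 1≤k)
                                                      (λ g {k} k<len 1≤k → g k 1≤k k<len)
                                                      (allUpTo? prefix? (length xs))
  where
  prefix? : ∀ k → Dec (1 ≤ k → ZeroDominated (take k xs))
  prefix? k = (1 ≤? k) →-dec (ones (take k xs) <? zeros (take k xs))

connected? : ∀ {n} (α : Tuple n) i j → Dec (Connected α i j)
connected? α i j = isZero? α i ×-dec isOne? α j ×-dec minimalBalanced? (seg α i j)

unboundOne? : ∀ {n} (α : Tuple n) → Decidable (UnboundOne α)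
unboundOne? α j = isOne? α j ×-dec ¬? (FP.any? (λ i → connected? α i j))

largest : ∀ n {P : Pred (Fin n) 0ℓ} → Decidable P → ∃ P →
          ∃ λ j → P j × (∀ k → P k → toℕ k ≤ toℕ j)
largest zero    P? (() , _)
largest (suc n) {P} P? (w , Pw) with FP.any? (λ k → P? (suc k))
... | yes inTail with largest n (λ k → P? (suc k)) inTail
...   | j , Pj , maximal = suc j , Pj , bound
  where
  bound : ∀ k → P k → toℕ k ≤ suc (toℕ j)
  bound zero    _  = z≤n
  bound (suc k) Pk = s≤s (maximal k Pk)
largest (suc n) {P} P? (zero , P0) | no notInTail = zero , P0 , bound
  where
  bound : ∀ k → P k → toℕ k ≤ 0
  bound zero    _  = z≤n
  bound (suc k) Pk = ⊥-elim (notInTail (k , Pk))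
largest (suc n) {P} P? (suc w , Pw) | no notInTail = ⊥-elim (notInTail (w , Pw))

∈-remove : {A : Set} {y y' : A} (as bs : List A) → y' ∈ as ++ y ∷ bs → y' ≢ y → y' ∈ as ++ bs
∈-remove []       bs (here y'≡y)  y'≢y = ⊥-elim (y'≢y y'≡y)
∈-remove []       bs (there y'∈)  _    = y'∈
∈-remove (a ∷ as) bs (here y'≡a)  _    = here y'≡a
∈-remove (a ∷ as) bs (there y'∈)  y'≢y = there (∈-remove as bs y'∈ y'≢y)

length-≤-byInjection : {A B : Set} (R : A → B → Set) (xs : List A) (ys : List B) → Unique xs →
  (∀ {x} → x ∈ xs → ∃ λ y → y ∈ ys × R x y) →
  (∀ {x x' y} → x ∈ xs → x' ∈ xs → R x y → R x' y → x ≡ x') →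
  length xs ≤ length ys
length-≤-byInjection R []       ys _               _     _   = z≤n
length-≤-byInjection R (x ∷ xs) ys (x∉xs ∷ unique) image inj with image (here refl)
... | y , y∈ys , Rxy with ∈-∃++ y∈ys
...   | as , bs , refl = subst (suc (length xs) ≤_) (sym (length-++-sucʳ as y bs)) (s≤s rest)
  where
  image' : ∀ {x'} → x' ∈ xs → ∃ λ y' → y' ∈ as ++ bs × R x' y'
  image' x'∈xs with image (there x'∈xs)
  ... | y' , y'∈ , Rx'y' =
    y' , ∈-remove as bs y'∈ (λ { refl → All.lookup x∉xs x'∈xs (inj (here refl) (there x'∈xs) Rxy Rx'y') }) , Rx'y'
  rest : length xs ≤ length (as ++ bs)
  rest = length-≤-byInjection R xs (as ++ bs) unique image' (λ x∈ x'∈ → inj (there x∈) (there x'∈))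

ones+zeros : ∀ bs → ones bs + zeros bs ≡ length bs
ones+zeros []           = refl
ones+zeros (true ∷ bs)  = cong suc (ones+zeros bs)
ones+zeros (false ∷ bs) = trans (+-suc (ones bs) (zeros bs)) (cong suc (ones+zeros bs))

ones-map : ∀ {n} (α : Tuple n) xs → ones (map α xs) ≡ length (filter (isOne? α) xs)
ones-map α []       = refl
ones-map α (x ∷ xs) with α x
... | true  = cong suc (ones-map α xs)
... | false = ones-map α xs

zeros-map : ∀ {n} (α : Tuple n) xs → zeros (map α xs) ≡ length (filter (isZero? α) xs)
zeros-map α []       = refl
zeros-map α (x ∷ xs) with α x
... | true  = zeros-map α xs
... | false = cong suc (zeros-map α xs)

onesT+zerosT : ∀ {n} (α : Tuple n) → onesT α + zeros (map α (allFin n)) ≡ n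
onesT+zerosT {n} α = begin
  onesT α + zeros (map α (allFin n)) ≡⟨ ones+zeros (map α (allFin n)) ⟩
  length (map α (allFin n))          ≡⟨ length-map α (allFin n) ⟩
  length (allFin n)                  ≡⟨ length-tabulate (λ k → k) ⟩
  n                                  ∎
  where open ≡-Reasoning

-- If every 1 except possibly the one at j is bound, then #ones ≤ #zeros + 1: send each
-- bound 1 to its partner 0 (injective by connected-unique) and j to an extra point j.
ones≤zeros+1 : ∀ {n} (α : Tuple n) (j : Fin n) →
  (∀ k → α k ≡ true → k ≢ j → BoundOne α k) →
  onesT α ≤ suc (zeros (map α (allFin n)))
ones≤zeros+1 {n} α j bound
  rewrite ones-map α (allFin n) | zeros-map α (allFin n) =
  length-≤-byInjection Partner oneIndices (j ∷ zeroIndices)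
    (Unique.filter⁺ (isOne? α) (Unique.allFin⁺ n)) partner partner-injective
  where
  oneIndices zeroIndices : List (Fin n)
  oneIndices  = filter (isOne? α) (allFin n)
  zeroIndices = filter (isZero? α) (allFin n)
  Partner : Fin n → Fin n → Set
  Partner k y = (k ≡ j × y ≡ j) ⊎ Connected α y k
  isOne : ∀ {k} → k ∈ oneIndices → α k ≡ true
  isOne k∈ = proj₂ (∈-filter⁻ (isOne? α) {xs = allFin n} k∈)
  notZero : ∀ {k} → k ∈ oneIndices → α k ≢ false
  notZero k∈ αk≡0 = true≢false (trans (sym (isOne k∈)) αk≡0)
  partner : ∀ {k} → k ∈ oneIndices → ∃ λ y → y ∈ j ∷ zeroIndices × Partner k y
  partner {k} k∈ with k FP.≟ j
  ... | yes k≡j = j , here refl , inj₁ (k≡j , refl)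
  ... | no  k≢j with bound k (isOne k∈) k≢j
  ...   | i , i~k = i , there (∈-filter⁺ (isZero? α) (∈-allFin i) (proj₁ i~k)) , inj₂ i~k
  -- the extra point j is never a partner 0, since j carries a 1 whenever it is used
  partner-injective : ∀ {k k' y} → k ∈ oneIndices → k' ∈ oneIndices → Partner k y → Partner k' y → k ≡ k'
  partner-injective _  _   (inj₁ (k≡j , _))      (inj₁ (k'≡j , _))  = trans k≡j (sym k'≡j)
  partner-injective k∈ _   (inj₁ (refl , refl))  (inj₂ (j≡0 , _))   = ⊥-elim (notZero k∈ j≡0)
  partner-injective _  k'∈ (inj₂ (j≡0 , _))      (inj₁ (refl , refl)) = ⊥-elim (notZero k'∈ j≡0)
  partner-injective _  _   (inj₂ y~k)            (inj₂ y~k')        = connected-unique α y~k y~k'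

unboundOne-elsewhere : ∀ {n} (α : Tuple n) → n + 2 ≤ 2 * onesT α →
                       (j : Fin n) → ∃ λ k → k ≢ j × UnboundOne α k
unboundOne-elsewhere {n} α many j with FP.any? (λ k → ¬? (k FP.≟ j) ×-dec unboundOne? α k)
... | yes found   = found
... | no  missing = ⊥-elim (≤⇒≯ few (subst (_≤ 2 * onesT α) (+-comm n 2) many))
  where
  open ≤-Reasoning
  o z : ℕ
  o = onesT α
  z = zeros (map α (allFin n))
  allBound : ∀ k → α k ≡ true → k ≢ j → BoundOne α k
  allBound k αk≡1 k≢j with FP.any? (λ i → connected? α i k)
  ... | yes bound = bound
  ... | no  free  = ⊥-elim (missing (k , k≢j , αk≡1 , free))
  few : 2 * o ≤ suc n
  few = begin
    o + (o + 0) ≡⟨ cong (o +_) (+-identityʳ o) ⟩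
    o + o       ≤⟨ +-monoʳ-≤ o (ones≤zeros+1 α j allBound) ⟩
    o + suc z   ≡⟨ +-suc o z ⟩
    suc (o + z) ≡⟨ cong suc (onesT+zerosT α) ⟩
    suc n       ∎

≰⇒1-0 : ∀ a b → ¬ (a B.≤ b) → a ≡ true × b ≡ false
≰⇒1-0 false false a≰b = ⊥-elim (a≰b B.b≤b)
≰⇒1-0 false true  a≰b = ⊥-elim (a≰b B.f≤t)
≰⇒1-0 true  false _   = refl , refl
≰⇒1-0 true  true  a≰b = ⊥-elim (a≰b B.b≤b)

violation : ∀ {n} (α β : Tuple n) → ¬ (α ≤ᵗ β) → ∃ λ k → α k ≡ true × β k ≡ false
violation {n} α β α≰β with FP.¬∀⟶∃¬ n (λ k → α k B.≤ β k) (λ k → α k BP.≤? β k) α≰β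
... | k , αk≰βk = k , ≰⇒1-0 (α k) (β k) αk≰βk

UpwardClosed : ∀ {n} → Tuple n → Set
UpwardClosed {n} β = ∀ {k j : Fin n} → toℕ k ≤ toℕ j → β k ≡ true → β j ≡ true

gamma-upwardClosed : ∀ n s → UpwardClosed (gamma n s)
gamma-upwardClosed n s {k} k≤j γk≡1 =
  Equivalence.to BP.T-≡ (≤⇒≤ᵇ (≤-trans (≤ᵇ⇒≤ (n ∸ s) (toℕ k) (Equivalence.from BP.T-≡ γk≡1)) k≤j))

largestUnboundOne : ∀ {n} (α : Tuple n) → 0 < n → n + 2 ≤ 2 * onesT α → ∃ (LargestUnboundOne α)
largestUnboundOne {n} α 0<n many with unboundOne-elsewhere α many (fromℕ< 0<n)
... | k , _ , unbound-k = largest n (unboundOne? α) (k , unbound-k)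

-- If α ≰ β with β upward closed, then a violation of α ≤ β remains away from the
-- largest unbound 1 j: either a violating index differs from j, or β_j = 0, and
-- then any other unbound 1 lies below j and so faces a 0 of β as well.
violation-besides : ∀ {n} (α β : Tuple n) → UpwardClosed β → n + 2 ≤ 2 * onesT α → ¬ (α ≤ᵗ β) →
  (j : Fin n) → LargestUnboundOne α j → ∃ λ w → w ≢ j × α w ≡ true × β w ≡ false
violation-besides α β upward many α≰β j (_ , maximal) with β j BP.≟ true
... | yes βj≡1 with violation α β α≰β
...   | k , αk≡1 , βk≡0 = k , (λ { refl → true≢false (trans (sym βj≡1) βk≡0) }) , αk≡1 , βk≡0
violation-besides α β upward many α≰β j (_ , maximal) | no βj≢1 with unboundOne-elsewhere α many j
...   | k , k≢j , unbound-k@(αk≡1 , _) =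
  k , k≢j , αk≡1 , BP.¬-not (λ βk≡1 → βj≢1 (upward (maximal k unbound-k) βk≡1))

surviving-one : ∀ {n} (α β : Tuple n) {j w : Fin n} → w ≢ j → α w ≡ true → β w ≡ false →
                ¬ (replaceByZero α j ≤ᵗ β)
surviving-one α β {j} {w} w≢j αw≡1 βw≡0 D≤β =
  true≰false (subst₂ B._≤_ (trans (updateAt-minimal w j α w≢j) αw≡1) βw≡0 (D≤β w))
  where
  true≰false : ¬ (true B.≤ false)
  true≰false ()

lemma4 : (n s : ℕ) → 1 ≤ n → n < 2 * s → s ≤ n →
         (α : Tuple n) → n + 2 ≤ 2 * onesT α → ¬ (α ≤ᵗ gamma n s) →
         Σ (Fin n) (λ j → LargestUnboundOne α j × ¬ (replaceByZero α j ≤ᵗ gamma n s))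
lemma4 n s 1≤n _ _ α many α≰γ with largestUnboundOne α 1≤n many
... | j , largest-j with violation-besides α (gamma n s) (gamma-upwardClosed n s) many α≰γ j largest-j
... | w , w≢j , αw≡1 , γw≡0 = j , largest-j , surviving-one α (gamma n s) w≢j αw≡1 γw≡0
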